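{- Let $n\ge 1$ and let $q$ be a product of $k\ge 1$ pairwise distinct primes. Then $\mathrm{DI}(\mathbf{INDEX}_n,q)=\lceil n/k\rceil$.
   Context: For a predicate $P:\mathcal X\times\mathcal Y\to\{0,1\}$ (finite sets) and integer $q\ge2$, an inner product encoding of $P$ modulo $q$ of length $\ell$ is a pair of maps $x\mapsto \vec x\in\mathbb Z_q^\ell$, $y\mapsto\vec y\in\mathbb Z_q^\ell$ such that for all $x,y$: $P(x,y)=1$ iff $\sum_{i=1}^\ell\vec x_i\vec y_i\equiv0\pmod q$; $\mathrm{DI}(P,q)$ is the minimum such $\ell$. The index predicate $\mathbf{INDEX}_n:\{0,1\}^n\times[n]\to\{0,1\}$ is $\mathbf{INDEX}_n(x,i)=1$ iff $x_i=0$. -}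

module Defs where

open import Data.Nat using (ℕ; zero; suc; _+_; _∸_; _*_; _/_; _%_; _≤_; NonZero)
open import Data.Nat.Primality using (Prime)
open import Data.Fin using (Fin; toℕ)
open import Data.Bool using (Bool; true; false)
open import Data.List using (List; length)
open import Data.Nat.ListAction using (product)
open import Data.List.Relation.Unary.All using (All)
open import Data.List.Relation.Unary.Unique.Propositional using (Unique)
open import Data.Product using (Σ; _×_; ∃; ∃-syntax)
open import Data.Vec.Functional using (Vector; foldr)
open import Relation.Binary.PropositionalEquality using (_≡_)
open import Function.Bundles using (_⇔_)

-- Inner product over Z_q, with Z_q represented by Fin q; computed in ℕ
-- and then reduced modulo q.
dot : ∀ {ℓ q} → Vector (Fin q) ℓ → Vector (Fin q) ℓ → ℕ
dot {ℓ} u v = foldr _+_ 0 (λ i → toℕ (u i) * toℕ (v i))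

-- P(x,y) = 1 is represented as P x y ≡ true.
-- An inner product encoding of P modulo q of length ℓ.
IPEncoding : {X Y : Set} → (X → Y → Bool) → (q : ℕ) → .{{NonZero q}} → ℕ → Set
IPEncoding {X} {Y} P q ℓ =
  Σ (X → Vector (Fin q) ℓ) λ ex →
  Σ (Y → Vector (Fin q) ℓ) λ ey →
  ∀ x y → (P x y ≡ true) ⇔ (dot (ex x) (ey y) % q ≡ 0)

DIis : {X Y : Set} → (X → Y → Bool) → (q : ℕ) → .{{NonZero q}} → ℕ → Set
DIis P q ℓ = IPEncoding P q ℓ × (∀ m → IPEncoding P q m → ℓ ≤ m)

-- INDEX_n(x,i) = 1 iff x_i = 0, with x ∈ {0,1}^n as Fin n → Bool
-- (false = 0, true = 1) and [n] as Fin n.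
isZero : Bool → Bool
isZero false = true
isZero true  = false

INDEX : (n : ℕ) → (Fin n → Bool) → Fin n → Bool
INDEX n x i = isZero (x i)

ProductOfDistinctPrimes : ℕ → ℕ → Set
ProductOfDistinctPrimes q k =
  ∃[ ps ] (length ps ≡ k × All Prime ps × Unique ps × product ps ≡ q)

ceilDiv : (n k : ℕ) → .{{NonZero k}} → ℕ
ceilDiv n k = (n + (k ∸ 1)) / k

module Submission where

-- Lower bound: from an encoding of length m put u i = ex(eᵢ) and v j = ey(j); then
-- q ∣ u i ∙ v j exactly when i ≢ j. For a prime p ∣ q the indices i with p ∤ u i ∙ v i
-- form a family whose Gram matrix is invertible and diagonal over 𝔽ₚ, so Gaussian
-- elimination shows there are at most m of them; every index is counted by one of the
-- k primes, hence n ≤ k m.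
-- Upper bound: cut the n positions into ⌈n/k⌉ blocks of k. Position t of a block adds its
-- bit times q / pₜ to the coordinate of the block, and the query for that position puts
-- q / pₜ in that coordinate. Modulo pₜ all other positions of the block vanish, and modulo
-- every other prime the query itself does.

open import Defs
open import Data.Nat.Properties renaming (_≟_ to _≟ℕ_)
open import Algebra.Properties.Semiring.Sum +-*-semiring
  using (sum; sum-cong-≗; ∑-distrib-+; *-distribˡ-sum)
open import Data.Bool using (Bool; true; false; if_then_else_)
open import Data.Fin using (Fin; zero; suc; toℕ; punchIn; inject≤; remQuot; combine; _≟_)
open import Data.Fin.Properties
  using (any?; punchIn-injective; punchInᵢ≢i; inject≤-injective; combine-remQuot; toℕ-fromℕ<)
  renaming (suc-injective to Fin-suc-injective)
open import Data.List using (List; []; _∷_; length; lookup; filter)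
open import Data.List.Properties using (length-tabulate)
open import Data.List.Membership.Propositional using (_∈_)
open import Data.List.Membership.Propositional.Properties using (∈-lookup)
open import Data.List.Relation.Unary.All as All using (All; []; _∷_)
open import Data.List.Relation.Unary.All.Properties using (¬All⇒Any¬; all-filter; tabulate⁺)
  renaming (filter⁺ to All-filter⁺)
open import Data.List.Relation.Unary.Any as Any using (Any)
open import Data.List.Relation.Unary.AllPairs using ([]; _∷_)
open import Data.List.Relation.Unary.Unique.Propositional using (Unique)
open import Data.List.Relation.Unary.Unique.Propositional.Properties using (allFin⁺)
  renaming (filter⁺ to Unique-filter⁺)
open import Data.Nat
  using (ℕ; zero; suc; _+_; _*_; _/_; _%_; _≤_; _<_; z≤n; s≤s; s≤s⁻¹; pred; NonZero; ≢-nonZero; ≢-nonZero⁻¹; nonTrivial⇒n>1)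
open import Data.Nat.DivMod using (_mod_; m≡m%n+[m/n]*n; m%n<n; m/n*n≡m; m/n<m; m<n*o⇒m/o<n; %-distribˡ-*)
open import Data.Nat.Divisibility
open import Data.Nat.ListAction using (product)
open import Data.Nat.ListAction.Properties using (∈⇒∣product)
open import Data.Nat.Primality
  using (Prime; ¬prime[1]; euclidsLemma; prime⇒irreducible; prime⇒nonZero; prime⇒nonTrivial; productOfPrimes≢0)
open import Data.Nat.Primality.Factorisation using (factorisationHasAllPrimeFactors)
open import Data.Product using (∃₂; _×_; _,_; proj₁; proj₂; uncurry)
open import Data.Sum using (inj₁; inj₂)
open import Data.Vec.Functional using (Vector; head; tail)
open import Function using (_∘_; id)
open import Function.Bundles using (_⇔_; mk⇔; Equivalence)
open import Function.Properties.Equivalence using () renaming (trans to ⇔-trans; sym to ⇔-sym)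
open import Function.Related.Propositional using (module EquationalReasoning)
open import Relation.Binary.PropositionalEquality
open import Relation.Nullary using (yes; no; does; contradiction)
open import Relation.Nullary.Decidable using (¬?; decidable-stable)
open import Relation.Unary using (Decidable)
open import Relation.Unary.Properties using (∁?)

∣m⇒∣m+n⇔∣n : ∀ {d m n} → d ∣ m → d ∣ m + n ⇔ d ∣ n
∣m⇒∣m+n⇔∣n d∣m = mk⇔ (λ d∣m+n → ∣m+n∣m⇒∣n d∣m+n d∣m) (∣m∣n⇒∣m+n d∣m)

∣n⇒∣m+n⇔∣m : ∀ {d m n} → d ∣ n → d ∣ m + n ⇔ d ∣ m
∣n⇒∣m+n⇔∣m {d} {m} {n} d∣n =
  ⇔-trans (mk⇔ (subst (d ∣_) (+-comm m n)) (subst (d ∣_) (+-comm n m))) (∣m⇒∣m+n⇔∣n d∣n)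

∣-sum : ∀ {d n} (f : Vector ℕ n) → (∀ j → d ∣ f j) → d ∣ sum f
∣-sum {d} {zero}  f _     = d ∣0
∣-sum {n = suc n} f d∣f = ∣m∣n⇒∣m+n (d∣f zero) (∣-sum (tail f) (d∣f ∘ suc))

∣-sum⇔∣-term : ∀ {d n} (f : Vector ℕ n) i → (∀ j → j ≢ i → d ∣ f j) → d ∣ sum f ⇔ d ∣ f i
∣-sum⇔∣-term f zero    others = ∣n⇒∣m+n⇔∣m (∣-sum (tail f) (λ j → others (suc j) λ ()))
∣-sum⇔∣-term f (suc i) others = ⇔-trans (∣m⇒∣m+n⇔∣n (others zero λ ()))
  (∣-sum⇔∣-term (tail f) i (λ j j≢i → others (suc j) (j≢i ∘ Fin-suc-injective)))

-- Biorthogonal families modulo a prime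

infix 7 _∙_

_∙_ : ∀ {ℓ} → Vector ℕ ℓ → Vector ℕ ℓ → ℕ
u ∙ v = sum (λ t → u t * v t)

∙-linearˡ : ∀ {ℓ} a c (x y v : Vector ℕ ℓ) →
  (λ t → a * x t + c * y t) ∙ v ≡ a * (x ∙ v) + c * (y ∙ v)
∙-linearˡ a c x y v = begin
  sum (λ t → (a * x t + c * y t) * v t)        ≡⟨ sum-cong-≗ (λ t → distrib (x t) (y t) (v t)) ⟩
  sum (λ t → a * xv t + c * yv t)              ≡⟨ ∑-distrib-+ (λ t → a * xv t) (λ t → c * yv t) ⟩
  sum (λ t → a * xv t) + sum (λ t → c * yv t)  ≡⟨ cong₂ _+_ (*-distribˡ-sum a xv) (*-distribˡ-sum c yv) ⟨
  a * sum xv + c * sum yv                      ∎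
  where
  open ≡-Reasoning
  xv yv : Vector ℕ _
  xv t = x t * v t
  yv t = y t * v t
  distrib : ∀ x y v → (a * x + c * y) * v ≡ a * (x * v) + c * (y * v)
  distrib x y v = trans (*-distribʳ-+ v (a * x) (c * y)) (cong₂ _+_ (*-assoc a x v) (*-assoc c y v))

∙-tail⇔ : ∀ {p ℓ} (u v : Vector ℕ (suc ℓ)) → p ∣ head u → p ∣ u ∙ v ⇔ p ∣ tail u ∙ tail v
∙-tail⇔ u v p∣u₀ = ∣m⇒∣m+n⇔∣n (∣m⇒∣m*n (head v) p∣u₀)

record Biorthogonal (p : ℕ) {m ℓ} (u v : Fin m → Vector ℕ ℓ) : Set where
  field
    offDiagonal : ∀ {i j} → i ≢ j → p ∣ u i ∙ v j
    diagonal    : ∀ i → p ∤ u i ∙ v i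

open Biorthogonal

biorthogonal-tail : ∀ {p m ℓ} {u v : Fin m → Vector ℕ (suc ℓ)} →
  (∀ i → p ∣ head (u i)) → Biorthogonal p u v → Biorthogonal p (tail ∘ u) (tail ∘ v)
biorthogonal-tail {u = u} {v} p∣heads b = record
  { offDiagonal = λ {i} {j} i≢j → Equivalence.to (∙-tail⇔ (u i) (v j) (p∣heads i)) (offDiagonal b i≢j)
  ; diagonal    = λ i → diagonal b i ∘ Equivalence.from (∙-tail⇔ (u i) (v i) (p∣heads i))
  }

-- Row j becomes a·(row j) + (p - 1)·b·(row i₀), where a and b are the first entries of
-- rows i₀ and j; its first entry a b + (p - 1) b a = p a b then vanishes modulo p.
eliminate : ∀ {m ℓ} → ℕ → (Fin (suc m) → Vector ℕ (suc ℓ)) → Fin (suc m) → Fin m → Vector ℕ (suc ℓ)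
eliminate p u i₀ j t = head (u i₀) * u (punchIn i₀ j) t + pred p * head (u (punchIn i₀ j)) * u i₀ t

eliminate-head : ∀ {m ℓ} p .{{_ : NonZero p}} (u : Fin (suc m) → Vector ℕ (suc ℓ)) i₀ j →
  p ∣ head (eliminate p u i₀ j)
eliminate-head p u i₀ j = divides (a * b) (begin
  a * b + pred p * b * a    ≡⟨ cong (a * b +_) (trans (*-assoc (pred p) b a) (cong (pred p *_) (*-comm b a))) ⟩
  suc (pred p) * (a * b)    ≡⟨ cong (_* (a * b)) (suc-pred p) ⟩
  p * (a * b)               ≡⟨ *-comm p (a * b) ⟩
  a * b * p                 ∎)
  where
  open ≡-Reasoning
  a = head (u i₀)
  b = head (u (punchIn i₀ j))

eliminate-biorthogonal : ∀ {p m ℓ} {u v : Fin (suc m) → Vector ℕ (suc ℓ)} → Prime p → ∀ i₀ →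
  p ∤ head (u i₀) → Biorthogonal p u v → Biorthogonal p (eliminate p u i₀) (v ∘ punchIn i₀)
eliminate-biorthogonal {p} {u = u} {v} p-prime i₀ p∤a b = record { offDiagonal = off ; diagonal = diag }
  where
  a = head (u i₀)
  ι = punchIn i₀

  expand : ∀ i j →
    eliminate p u i₀ i ∙ v (ι j) ≡ a * (u (ι i) ∙ v (ι j)) + pred p * head (u (ι i)) * (u i₀ ∙ v (ι j))
  expand i j = ∙-linearˡ a (pred p * head (u (ι i))) (u (ι i)) (u i₀) (v (ι j))

  p∣pivotTerm : ∀ i j → p ∣ pred p * head (u (ι i)) * (u i₀ ∙ v (ι j))
  p∣pivotTerm i j = ∣n⇒∣m*n (pred p * head (u (ι i))) (offDiagonal b (punchInᵢ≢i i₀ j ∘ sym))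

  off : ∀ {i j} → i ≢ j → p ∣ eliminate p u i₀ i ∙ v (ι j)
  off {i} {j} i≢j = subst (p ∣_) (sym (expand i j))
    (∣m∣n⇒∣m+n (∣n⇒∣m*n a (offDiagonal b (i≢j ∘ punchIn-injective i₀ i j))) (p∣pivotTerm i j))

  diag : ∀ i → p ∤ eliminate p u i₀ i ∙ v (ι i)
  diag i p∣ with euclidsLemma a _ p-prime
    (Equivalence.to (∣n⇒∣m+n⇔∣m (p∣pivotTerm i i)) (subst (p ∣_) (expand i i) p∣))
  ... | inj₁ p∣a = p∤a p∣a
  ... | inj₂ p∣d = diagonal b (ι i) p∣d

biorthogonal⇒≤ : ∀ {p m ℓ} {u v : Fin m → Vector ℕ ℓ} → Prime p → Biorthogonal p u v → m ≤ ℓ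
biorthogonal⇒≤ {m = zero} _ _ = z≤n
biorthogonal⇒≤ {p} {suc m} {zero} _ b = contradiction (p ∣0) (diagonal b zero)
biorthogonal⇒≤ {p} {suc m} {suc ℓ} {u} p-prime b with any? (λ i → ¬? (p ∣? head (u i)))
... | yes (i₀ , p∤pivot) = s≤s (biorthogonal⇒≤ p-prime (biorthogonal-tail
  (eliminate-head p {{prime⇒nonZero p-prime}} u i₀) (eliminate-biorthogonal p-prime i₀ p∤pivot b)))
... | no noPivot = m≤n⇒m≤1+n (biorthogonal⇒≤ p-prime
  (biorthogonal-tail (λ i → decidable-stable (p ∣? head (u i)) (noPivot ∘ (i ,_))) b))

Unique⇒lookup-injective : ∀ {A : Set} {xs : List A} → Unique xs →
  ∀ {i j} → lookup xs i ≡ lookup xs j → i ≡ j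
Unique⇒lookup-injective (_ ∷ _)      {zero}  {zero}  _  = refl
Unique⇒lookup-injective (x∉xs ∷ _)   {zero}  {suc j} eq = contradiction eq (All.lookup x∉xs (∈-lookup j))
Unique⇒lookup-injective (x∉xs ∷ _)   {suc i} {zero}  eq = contradiction (sym eq) (All.lookup x∉xs (∈-lookup i))
Unique⇒lookup-injective (_ ∷ unique) {suc i} {suc j} eq = cong suc (Unique⇒lookup-injective unique eq)

length-filter+length-filter-∁ : ∀ {A : Set} {P : A → Set} (P? : Decidable P) xs →
  length (filter P? xs) + length (filter (∁? P?) xs) ≡ length xs
length-filter+length-filter-∁ P? []       = refl
length-filter+length-filter-∁ P? (x ∷ xs) with does (P? x)
... | true  = cong suc (length-filter+length-filter-∁ P? xs)
... | false = trans (+-suc _ _) (cong suc (length-filter+length-filter-∁ P? xs))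

length-≤-covered : ∀ {A B : Set} (R : B → A → Set) (R? : ∀ b → Decidable (R b)) {m} bs →
  All (λ b → ∀ {ys} → Unique ys → All (R b) ys → length ys ≤ m) bs →
  ∀ {xs} → Unique xs → All (λ x → Any (λ b → R b x) bs) xs → length xs ≤ length bs * m
length-≤-covered R R? []       []               {[]}    _      _            = z≤n
length-≤-covered R R? []       []               {_ ∷ _} _      (() ∷ _)
length-≤-covered R R? {m} (b ∷ bs) (bound ∷ bounds) {xs} unique covered = begin
  length xs                                                    ≡⟨ length-filter+length-filter-∁ (R? b) xs ⟨
  length (filter (R? b) xs) + length (filter (∁? (R? b)) xs)  ≤⟨ +-mono-≤ inB inRest ⟩
  m + length bs * m                                            ∎
  where
  open ≤-Reasoning
  inB : length (filter (R? b) xs) ≤ m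
  inB = bound (Unique-filter⁺ (R? b) unique) (all-filter (R? b) xs)
  inRest : length (filter (∁? (R? b)) xs) ≤ length bs * m
  inRest = length-≤-covered R R? bs bounds (Unique-filter⁺ (∁? (R? b)) unique)
    (All.zipWith (uncurry Any.tail) (all-filter (∁? (R? b)) xs , All-filter⁺ (∁? (R? b)) covered))

-- Products of distinct primes

prime∣prime⇒≡ : ∀ {p r} → Prime p → Prime r → p ∣ r → p ≡ r
prime∣prime⇒≡ p-prime r-prime p∣r with prime⇒irreducible r-prime p∣r
... | inj₁ p≡1 = contradiction (subst Prime p≡1 p-prime) ¬prime[1]
... | inj₂ p≡r = p≡r

prime∤∧∣⇒*∣ : ∀ {p n d} → Prime p → p ∤ n → p ∣ d → n ∣ d → p * n ∣ d
prime∤∧∣⇒*∣ {n = n} p-prime p∤n p∣d (divides-refl c) with euclidsLemma c n p-prime p∣d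
... | inj₁ p∣c = *-monoˡ-∣ n p∣c
... | inj₂ p∣n = contradiction p∣n p∤n

product∣⇔All∣ : ∀ {ps} → All Prime ps → Unique ps → ∀ {d} → product ps ∣ d ⇔ All (_∣ d) ps
product∣⇔All∣ primes distinct = mk⇔
  (λ Π∣d → All.tabulate (λ p∈ps → ∣-trans (∈⇒∣product p∈ps) Π∣d))
  (All∣⇒product∣ primes distinct)
  where
  All∣⇒product∣ : ∀ {ps d} → All Prime ps → Unique ps → All (_∣ d) ps → product ps ∣ d
  All∣⇒product∣ []                     []                 []             = 1∣ _
  All∣⇒product∣ (p-prime ∷ primes) (p∉ps ∷ distinct) (p∣d ∷ ps∣d) = prime∤∧∣⇒*∣ p-prime
    (λ p∣Π → All.lookup p∉ps (factorisationHasAllPrimeFactors p-prime p∣Π primes) refl)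
    p∣d (All∣⇒product∣ primes distinct ps∣d)

module _ {ps : List ℕ} (primes : All Prime ps) where

  lookup-prime : ∀ t → Prime (lookup ps t)
  lookup-prime t = All.lookup primes (∈-lookup t)

  cofactor : Fin (length ps) → ℕ
  cofactor t = _/_ (product ps) (lookup ps t) {{prime⇒nonZero (lookup-prime t)}}

  lookup∣product : ∀ t → lookup ps t ∣ product ps
  lookup∣product t = ∈⇒∣product (∈-lookup {xs = ps} t)

  product≡cofactor*lookup : ∀ t → product ps ≡ cofactor t * lookup ps t
  product≡cofactor*lookup t = sym (m/n*n≡m {{prime⇒nonZero (lookup-prime t)}} (lookup∣product t))

  ∣cofactor : ∀ {p} t → p ∈ ps → p ≢ lookup ps t → p ∣ cofactor t
  ∣cofactor {p} t p∈ps p≢r with euclidsLemma (cofactor t) _ (All.lookup primes p∈ps)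
    (subst (p ∣_) (product≡cofactor*lookup t) (∈⇒∣product p∈ps))
  ... | inj₁ p∣Q = p∣Q
  ... | inj₂ p∣r = contradiction (prime∣prime⇒≡ (All.lookup primes p∈ps) (lookup-prime t) p∣r) p≢r

  cofactor∣∧lookup∣⇒product∣ : Unique ps → ∀ t {d} → cofactor t ∣ d → lookup ps t ∣ d → product ps ∣ d
  cofactor∣∧lookup∣⇒product∣ distinct t {d} Q∣d r∣d =
    Equivalence.from (product∣⇔All∣ primes distinct) (All.tabulate ∣d)
    where
    ∣d : ∀ {p} → p ∈ ps → p ∣ d
    ∣d {p} p∈ps with p ≟ℕ lookup ps t
    ... | yes refl = r∣d
    ... | no p≢r   = ∣-trans (∣cofactor t p∈ps p≢r) Q∣d

  -- If lookup ps t divided its cofactor, so would every prime of ps, yet 0 < cofactor t < product ps.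
  lookup∤cofactor : Unique ps → ∀ t → lookup ps t ∤ cofactor t
  lookup∤cofactor distinct t r∣Q = <⇒≱ Q<Π (∣⇒≤ {{Q≢0}} (cofactor∣∧lookup∣⇒product∣ distinct t ∣-refl r∣Q))
    where
    instance
      _ = prime⇒nonZero (lookup-prime t)
      _ = prime⇒nonTrivial (lookup-prime t)
      _ = productOfPrimes≢0 primes
    Q<Π : cofactor t < product ps
    Q<Π = m/n<m (product ps) (lookup ps t) (nonTrivial⇒n>1 (lookup ps t))
    Q≢0 : NonZero (cofactor t)
    Q≢0 = ≢-nonZero λ Q≡0 →
      ≢-nonZero⁻¹ (product ps) (trans (product≡cofactor*lookup t) (cong (_* lookup ps t) Q≡0))

  product∣*cofactor⇔lookup∣ : Unique ps → ∀ t a → product ps ∣ a * cofactor t ⇔ lookup ps t ∣ a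
  product∣*cofactor⇔lookup∣ distinct t a = mk⇔ to from
    where
    to : product ps ∣ a * cofactor t → lookup ps t ∣ a
    to Π∣aQ with euclidsLemma a (cofactor t) (lookup-prime t) (∣-trans (lookup∣product t) Π∣aQ)
    ... | inj₁ r∣a = r∣a
    ... | inj₂ r∣Q = contradiction r∣Q (lookup∤cofactor distinct t)
    from : lookup ps t ∣ a → product ps ∣ a * cofactor t
    from r∣a = cofactor∣∧lookup∣⇒product∣ distinct t (n∣m*n a) (∣m⇒∣m*n (cofactor t) r∣a)

ceilDiv-least : ∀ {n k m} .{{_ : NonZero k}} → n ≤ k * m → ceilDiv n k ≤ m
ceilDiv-least {n} {k} {m} n≤km = s≤s⁻¹ (m<n*o⇒m/o<n (begin-strict
  n + pred k      ≤⟨ +-monoˡ-≤ (pred k) n≤km ⟩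
  k * m + pred k  <⟨ +-monoʳ-< (k * m) (subst (pred k <_) (suc-pred k) (n<1+n (pred k))) ⟩
  k * m + k       ≡⟨ trans (+-comm (k * m) k) (cong (k +_) (*-comm k m)) ⟩
  suc m * k       ∎))
  where open ≤-Reasoning

ceilDiv-cover : ∀ n k .{{_ : NonZero k}} → n ≤ ceilDiv n k * k
ceilDiv-cover n k = +-cancelʳ-≤ (pred k) n (ceilDiv n k * k) (begin
  n + pred k                          ≡⟨ m≡m%n+[m/n]*n (n + pred k) k ⟩
  (n + pred k) % k + ceilDiv n k * k  ≤⟨ +-monoˡ-≤ (ceilDiv n k * k) (<⇒≤pred (m%n<n (n + pred k) k)) ⟩
  pred k + ceilDiv n k * k            ≡⟨ +-comm (pred k) (ceilDiv n k * k) ⟩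
  ceilDiv n k * k + pred k            ∎)
  where open ≤-Reasoning

-- The lower bound

indicator : ∀ {n} → Fin n → Fin n → Bool
indicator i j = does (i ≟ j)

INDEX-indicator : ∀ {n} (i j : Fin n) → INDEX n (indicator i) j ≡ true ⇔ i ≢ j
INDEX-indicator i j with i ≟ j
... | yes refl = mk⇔ (λ ()) (λ i≢i → contradiction refl i≢i)
... | no i≢j   = mk⇔ (λ _ → i≢j) (λ _ → refl)

INDEX-encoding⇒biorthogonal : ∀ {n q m} .{{_ : NonZero q}} → IPEncoding (INDEX n) q m →
  ∃₂ λ (u v : Fin n → Vector ℕ m) → Biorthogonal q u v
INDEX-encoding⇒biorthogonal {n} {q} (ex , ey , correct) = u , v , record { offDiagonal = off ; diagonal = diag }
  where
  u v : Fin n → Vector ℕ _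
  u i = toℕ ∘ ex (indicator i)
  v j = toℕ ∘ ey j
  q∣⇔INDEX : ∀ i j → q ∣ u i ∙ v j ⇔ INDEX n (indicator i) j ≡ true
  q∣⇔INDEX i j = ⇔-trans (⇔-sym (m%n≡0⇔n∣m _ q)) (⇔-sym (correct (indicator i) j))
  off : ∀ {i j} → i ≢ j → q ∣ u i ∙ v j
  off {i} {j} i≢j = Equivalence.from (q∣⇔INDEX i j) (Equivalence.from (INDEX-indicator i j) i≢j)
  diag : ∀ i → q ∤ u i ∙ v i
  diag i q∣ = Equivalence.to (INDEX-indicator i i) (Equivalence.to (q∣⇔INDEX i i) q∣) refl

biorthogonal-squarefree⇒≤ : ∀ {ps m ℓ} {u v : Fin m → Vector ℕ ℓ} → All Prime ps → Unique ps →
  Biorthogonal (product ps) u v → m ≤ length ps * ℓ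
biorthogonal-squarefree⇒≤ {ps} {m} {ℓ} {u} {v} primes distinct b =
  subst (_≤ length ps * ℓ) (length-tabulate id)
    (length-≤-covered R R? ps (All.tabulate bound) (allFin⁺ m) (tabulate⁺ covered))
  where
  R : ℕ → Fin m → Set
  R p i = p ∤ u i ∙ v i
  R? : ∀ p → Decidable (R p)
  R? p i = ¬? (p ∣? u i ∙ v i)
  covered : ∀ i → Any (λ p → R p i) ps
  covered i = ¬All⇒Any¬ (_∣? u i ∙ v i) ps (diagonal b i ∘ Equivalence.from (product∣⇔All∣ primes distinct))
  bound : ∀ {p} → p ∈ ps → ∀ {ys} → Unique ys → All (R p) ys → length ys ≤ ℓ
  bound p∈ps {ys} unique p∤diagonal =
    biorthogonal⇒≤ {u = u ∘ lookup ys} {v ∘ lookup ys} (All.lookup primes p∈ps) (record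
      { offDiagonal = λ a≢b → ∣-trans (∈⇒∣product p∈ps) (offDiagonal b (a≢b ∘ Unique⇒lookup-injective unique))
      ; diagonal    = λ a → All.lookup p∤diagonal (∈-lookup a)
      })

-- The upper bound

∣mod*mod⇔∣* : ∀ q .{{_ : NonZero q}} a b → q ∣ toℕ (a mod q) * toℕ (b mod q) ⇔ q ∣ a * b
∣mod*mod⇔∣* q a b = begin
  q ∣ toℕ (a mod q) * toℕ (b mod q)  ≡⟨ cong₂ (λ a′ b′ → q ∣ a′ * b′) (toℕ-fromℕ< (m%n<n a q))
                                                                       (toℕ-fromℕ< (m%n<n b q)) ⟩
  q ∣ a % q * (b % q)                ∼⟨ ⇔-sym (m%n≡0⇔n∣m _ q) ⟩
  a % q * (b % q) % q ≡ 0            ≡⟨ cong (_≡ 0) (%-distribˡ-* a b q) ⟨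
  a * b % q ≡ 0                      ∼⟨ m%n≡0⇔n∣m _ q ⟩
  q ∣ a * b                          ∎
  where open EquationalReasoning

module _ {ps : List ℕ} (primes : All Prime ps) (distinct : Unique ps) (n : ℕ)
         .{{_ : NonZero (length ps)}} .{{_ : NonZero (product ps)}} where

  private
    k = length ps
    q = product ps
    c = ceilDiv n k

  embed : Fin n → Fin (c * k)
  embed i = inject≤ i (ceilDiv-cover n k)

  slot : Fin n → Fin c × Fin k
  slot i = remQuot k (embed i)

  slot-injective : ∀ {i j} → slot i ≡ slot j → i ≡ j
  slot-injective {i} {j} eq = inject≤-injective _ _ i j (begin
    embed i                   ≡⟨ combine-remQuot {c} k (embed i) ⟨
    uncurry combine (slot i)  ≡⟨ cong (uncurry combine) eq ⟩
    uncurry combine (slot j)  ≡⟨ combine-remQuot {c} k (embed j) ⟩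
    embed j                   ∎)
    where open ≡-Reasoning

  block : Fin n → Fin c
  block = proj₁ ∘ slot

  offset : Fin n → Fin k
  offset = proj₂ ∘ slot

  bitTerm : (Fin n → Bool) → Fin c → Fin n → ℕ
  bitTerm x j i = if does (block i ≟ j) then (if x i then cofactor primes (offset i) else 0) else 0

  bitsVector : (Fin n → Bool) → Vector ℕ c
  bitsVector x j = sum (bitTerm x j)

  indexVector : Fin n → Vector ℕ c
  indexVector i j = if does (j ≟ block i) then cofactor primes (offset i) else 0

  indexVector-block : ∀ i → indexVector i (block i) ≡ cofactor primes (offset i)
  indexVector-block i with block i ≟ block i
  ... | yes _    = refl
  ... | no b≢b  = contradiction refl b≢b

  indexVector-other : ∀ i {j} → j ≢ block i → indexVector i j ≡ 0
  indexVector-other i {j} j≢b with j ≟ block i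
  ... | yes j≡b = contradiction j≡b j≢b
  ... | no _    = refl

  lookup∣bitTerm-other : ∀ x i {i′} → i′ ≢ i → lookup ps (offset i) ∣ bitTerm x (block i) i′
  lookup∣bitTerm-other x i {i′} i′≢i with block i′ ≟ block i | x i′
  ... | no _     | _     = _ ∣0
  ... | yes _    | false = _ ∣0
  ... | yes same | true  = ∣cofactor primes (offset i′) (∈-lookup (offset i))
    (λ eq → i′≢i (slot-injective (cong₂ _,_ same (sym (Unique⇒lookup-injective distinct eq)))))

  lookup∣bitTerm-self⇔INDEX : ∀ x i → lookup ps (offset i) ∣ bitTerm x (block i) i ⇔ INDEX n x i ≡ true
  lookup∣bitTerm-self⇔INDEX x i with block i ≟ block i | x i
  ... | no b≢b | _     = contradiction refl b≢b
  ... | yes _  | true  = mk⇔ (λ r∣Q → contradiction r∣Q (lookup∤cofactor primes distinct (offset i))) (λ ())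
  ... | yes _  | false = mk⇔ (λ _ → refl) (λ _ → _ ∣0)

  INDEX-encoding : IPEncoding (INDEX n) q c
  INDEX-encoding = ex , ey , λ x i → ⇔-sym (dot%q≡0⇔INDEX x i)
    where
    ex : (Fin n → Bool) → Vector (Fin q) c
    ex x j = bitsVector x j mod q
    ey : Fin n → Vector (Fin q) c
    ey i j = indexVector i j mod q

    q∣dot-other : ∀ x i j → j ≢ block i → q ∣ toℕ (ex x j) * toℕ (ey i j)
    q∣dot-other x i j j≢b = Equivalence.from (∣mod*mod⇔∣* q (bitsVector x j) (indexVector i j))
      (∣n⇒∣m*n (bitsVector x j) (subst (q ∣_) (sym (indexVector-other i j≢b)) (q ∣0)))

    dot%q≡0⇔INDEX : ∀ x i → dot (ex x) (ey i) % q ≡ 0 ⇔ INDEX n x i ≡ true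
    dot%q≡0⇔INDEX x i = begin
      dot (ex x) (ey i) % q ≡ 0                 ∼⟨ m%n≡0⇔n∣m _ q ⟩
      q ∣ dot (ex x) (ey i)                     ∼⟨ ∣-sum⇔∣-term _ (block i) (q∣dot-other x i) ⟩
      q ∣ toℕ (ex x (block i)) * toℕ (ey i (block i))
                                                ∼⟨ ∣mod*mod⇔∣* q X (indexVector i (block i)) ⟩
      q ∣ X * indexVector i (block i)           ≡⟨ cong (λ a → q ∣ X * a) (indexVector-block i) ⟩
      q ∣ X * cofactor primes (offset i)        ∼⟨ product∣*cofactor⇔lookup∣ primes distinct (offset i) X ⟩
      lookup ps (offset i) ∣ X                  ∼⟨ ∣-sum⇔∣-term (bitTerm x (block i)) i (λ _ → lookup∣bitTerm-other x i) ⟩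
      lookup ps (offset i) ∣ bitTerm x (block i) i
                                                ∼⟨ lookup∣bitTerm-self⇔INDEX x i ⟩
      INDEX n x i ≡ true                        ∎
      where
      open EquationalReasoning
      X = bitsVector x (block i)

mainTheorem3 : (n k q : ℕ) → 1 ≤ n → 1 ≤ k → .{{_ : NonZero k}} → .{{_ : NonZero q}} →
    ProductOfDistinctPrimes q k → DIis (INDEX n) q (ceilDiv n k)
mainTheorem3 n _ _ _ _ (ps , refl , primes , distinct , refl) =
  INDEX-encoding primes distinct n ,
  λ m encoding → ceilDiv-least (biorthogonal-squarefree⇒≤ primes distinct
    (proj₂ (proj₂ (INDEX-encoding⇒biorthogonal encoding))))
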